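{- For every integer $n\geq 1$ and every $n$-vertex outerplanar graph $G$, there exists a set $\mathcal I\subseteq V(G)$ such that $G[\mathcal I]$ has maximum degree at most $3$ and $|\mathcal I|\geq \frac{2}{3}n$.
   Context: An outerplanar graph is a (simple) graph admitting a planar drawing in which every vertex is incident to the outer face. $G[\mathcal I]$ denotes the subgraph of $G$ induced by $\mathcal I$. -}

module Defs where

open import Data.Nat using (ℕ; _≤_)
open import Data.Bool using (Bool; true; false; _∧_)
open import Data.Fin using (Fin; _<_)
open import Data.Fin.Subset using (Subset; _∈_; ∣_∣)
open import Data.Fin.Permutation using (Permutation; _⟨$⟩ʳ_)
open import Data.Vec using (count; tabulate; lookup)
open import Data.Product using (_×_)
open import Relation.Binary.PropositionalEquality using (_≡_)
open import Relation.Nullary using (¬_)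
open import Data.Bool using (T)
open import Relation.Nullary.Decidable using (Dec)
open import Data.Bool.Properties using (T?)

record Graph (n : ℕ) : Set where
  field
    adj   : Fin n → Fin n → Bool
    sym   : ∀ u v → adj u v ≡ adj v u
    irrefl : ∀ v → adj v v ≡ false
open Graph public

-- An outerplanar embedding (combinatorial form): a cyclic placement of the
-- vertices on a circle, given by a permutation `pos` (vertex ↦ position),
-- such that no two edges cross as chords, i.e. there are no edges uv and xy
-- with pos u < pos x < pos v < pos y.
NonCrossing : ∀ {n} → Graph n → Permutation n n → Set
NonCrossing G π =
  ∀ u v x y → adj G u v ≡ true → adj G x y ≡ true →
    ¬ ((π ⟨$⟩ʳ u) < (π ⟨$⟩ʳ x) × (π ⟨$⟩ʳ x) < (π ⟨$⟩ʳ v) × (π ⟨$⟩ʳ v) < (π ⟨$⟩ʳ y))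

record Outerplanar {n : ℕ} (G : Graph n) : Set where
  field
    pos         : Permutation n n
    noncrossing : NonCrossing G pos

inducedDegree : ∀ {n} → Graph n → Subset n → Fin n → ℕ
inducedDegree G I v = count (λ u → T? (lookup I u ∧ adj G v u)) (tabulate (λ u → u))

InducedMaxDegree≤ : ∀ {n} → Graph n → Subset n → ℕ → Set
InducedMaxDegree≤ G I d = ∀ v → v ∈ I → inducedDegree G I v ≤ d

{-# OPTIONS --safe #-}
module Submission where

-- Read the vertices in the cyclic order of an outerplanar embedding as positions
-- 0, …, n − 1 on a line: the edges become pairwise noncrossing chords.  Call an
-- interval [a, b] closed if every chord from a position strictly between a and b
-- stays inside [a, b].  A closed interval with an interior position splits at k,
-- the leftmost interior neighbour of b (or b − 1 if b has none), into the closed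
-- intervals [a, k] and [k, b]; so the closed intervals below [0, n − 1] form a
-- binary tree whose leaves have no interior.
--
-- Deleted vertices are chosen bottom-up along this tree.  Each endpoint of an
-- interval is either deleted or kept with a budget j ≤ 2 for its kept interior
-- neighbours.  An interval with m interior positions gets one of eight profiles t,
-- meaning: for the endpoint states with bound t sa sb = just β, some set of c
-- interior vertices with 3c + 4 ≤ m + β can be deleted so that every kept interior
-- vertex keeps at most 3 kept neighbours and the endpoint budgets are respected.
-- Gluing [a, k] and [k, b] either deletes k or keeps it and splits its three
-- allowed neighbours among a, b and the two sides; a finite table, verified by
-- evaluation, shows that the result again has one of the eight profiles.  For the
-- root [0, n − 1] every profile has endpoint states giving 3(c + #deleted ends) ≤ n.

import Algebra.Properties.CommutativeMonoid.Sum
open import Data.Bool using (Bool; true; false; not; _∧_; _∨_; T)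
open import Data.Bool.ListAction using (all; any)
open import Data.Bool.Properties using (T-∧; T-∨; T-≡; ∧-zeroʳ; ∧-identityʳ; ∨-identityʳ; not-involutive)
import Data.Bool as Bool
open import Data.Empty using (⊥; ⊥-elim)
open import Data.Fin using (Fin; zero; suc; toℕ)
open import Data.Fin.Patterns using (0F; 1F; 2F; 3F; 4F; 5F; 6F; 7F)
open import Data.Fin.Permutation using (Permutation; _⟨$⟩ʳ_; _⟨$⟩ˡ_; inverseˡ; inverseʳ)
open import Data.Fin.Subset using (Subset; ∣_∣)
import Data.Fin as Fin
import Data.Fin.Properties as Fin
import Data.Fin.Subset as Subset
open import Data.List using (List; []; _∷_; allFin; cartesianProduct; cartesianProductWith)
open import Data.List.Membership.Propositional using (_∈_)
open import Data.List.Membership.Propositional.Properties using (∈-allFin; ∈-map⁺; ∈-cartesianProduct⁺)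
open import Data.List.Relation.Unary.All.Properties using (all⁺)
open import Data.List.Relation.Unary.Any using (here; there; satisfied)
open import Data.List.Relation.Unary.Any.Properties using (any⁻)
import Data.List as List
import Data.List.Relation.Unary.All as All
open import Data.Maybe using (Maybe; just; nothing)
open import Data.Nat using (ℕ; zero; suc; >-nonZero; _+_; _*_; _∸_; _≤_; _<_; _≤ᵇ_; _<ᵇ_; z≤n; s≤s)
open import Data.Nat.Induction using (<-wellFounded)
open import Data.Nat.Properties
open import Data.Nat.Tactic.RingSolver using (solve-∀)
import Data.Nat as ℕ
open import Data.Product using (Σ; ∃; ∃₂; _×_; _,_; proj₁; proj₂)
open import Data.Sum using (_⊎_; inj₁; inj₂)
import Data.Sum as Sum
open import Data.Unit using (⊤; tt)
open import Data.Vec using (Vec; []; _∷_; tabulate)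
open import Data.Vec.Properties using (lookup∘tabulate; []=⇒lookup)
import Data.Vec as Vec
open import Function using (id; _∘_; case_of_; Equivalence)
open import Induction.WellFounded using (Acc; acc)
open import Relation.Binary using (tri<; tri≈; tri>)
open import Relation.Binary.PropositionalEquality
open import Relation.Nullary using (¬_; does; yes; no; ¬?; _×-dec_; _⊎-dec_)
open import Relation.Nullary.Decidable using (decidable-stable; map′; T?)
open import Relation.Unary using (Pred; Decidable)

open import Defs hiding (sym)

-- Counting

T-∧⁺ : ∀ {x y} → T x → T y → T (x ∧ y)
T-∧⁺ tx ty = Equivalence.from T-∧ (tx , ty)

T-∧⁻ : ∀ {x y} → T (x ∧ y) → T x × T y
T-∧⁻ {x} = Equivalence.to (T-∧ {x})

¬T⇒≡false : ∀ {x} → ¬ T x → x ≡ false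
¬T⇒≡false {false} _  = refl
¬T⇒≡false {true}  ¬T = ⊥-elim (¬T _)

_≡ᵇ_ : ∀ {n} → Fin n → Fin n → Bool
u ≡ᵇ x = does (u Fin.≟ x)

≡ᵇ-refl : ∀ {n} (x : Fin n) → T (x ≡ᵇ x)
≡ᵇ-refl x with x Fin.≟ x
... | yes _   = _
... | no x≢x = x≢x refl

≡ᵇ-sound : ∀ {n} {u x : Fin n} → T (u ≡ᵇ x) → u ≡ x
≡ᵇ-sound {u = u} {x} _ with u Fin.≟ x
... | yes u≡x = u≡x

≢⇒≡ᵇ-false : ∀ {n} {u x : Fin n} → u ≢ x → (u ≡ᵇ x) ≡ false
≢⇒≡ᵇ-false u≢x = ¬T⇒≡false (u≢x ∘ ≡ᵇ-sound)

module Σℕ = Algebra.Properties.CommutativeMonoid.Sum +-0-commutativeMonoid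
open Σℕ using (sum)

sum-mono : ∀ {n} {f g : Fin n → ℕ} → (∀ i → f i ≤ g i) → sum f ≤ sum g
sum-mono {zero}  f≤g = z≤n
sum-mono {suc n} f≤g = +-mono-≤ (f≤g zero) (sum-mono (f≤g ∘ suc))

indicator : Bool → ℕ
indicator false = 0
indicator true  = 1

indicator-mono : ∀ {x y} → (T x → T y) → indicator x ≤ indicator y
indicator-mono {false}        _   = z≤n
indicator-mono {true} {true}  _   = ≤-refl
indicator-mono {true} {false} x⇒y = ⊥-elim (x⇒y _)

indicator≤1 : ∀ x → indicator x ≤ 1
indicator≤1 false = z≤n
indicator≤1 true  = ≤-refl

indicator-∨ : ∀ x y → indicator (x ∨ y) ≤ indicator x + indicator y
indicator-∨ false y = ≤-refl
indicator-∨ true  y = s≤s z≤n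

indicator-not : ∀ x → indicator x + indicator (not x) ≡ 1
indicator-not false = refl
indicator-not true  = refl

count : ∀ {n} → (Fin n → Bool) → ℕ
count p = sum (indicator ∘ p)

count-true : ∀ n → count {n} (λ _ → true) ≡ n
count-true zero    = refl
count-true (suc n) = cong suc (count-true n)

module _ {n : ℕ} where

  count-cong : {p q : Fin n → Bool} → (∀ u → p u ≡ q u) → count p ≡ count q
  count-cong p≗q = Σℕ.sum-cong-≗ (cong indicator ∘ p≗q)

  count-mono : {p q : Fin n → Bool} → (∀ u → T (p u) → T (q u)) → count p ≤ count q
  count-mono p⊆q = sum-mono (λ u → indicator-mono (p⊆q u))

  count-∨ : (p q : Fin n → Bool) → count (λ u → p u ∨ q u) ≤ count p + count q
  count-∨ p q = ≤-trans (sum-mono (λ u → indicator-∨ (p u) (q u)))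
                        (≤-reflexive (Σℕ.∑-distrib-+ (indicator ∘ p) (indicator ∘ q)))

  count-permute : (p : Fin n → Bool) (π : Permutation n n) → count p ≡ count (p ∘ (π ⟨$⟩ʳ_))
  count-permute p = Σℕ.sum-permute (indicator ∘ p)

  count≤n : (p : Fin n → Bool) → count p ≤ n
  count≤n p = ≤-trans (count-mono {p} {λ _ → true} (λ _ _ → _)) (≤-reflexive (count-true n))

  count-none : (p : Fin n → Bool) → (∀ u → ¬ T (p u)) → count p ≡ 0
  count-none p none =
    n≤0⇒n≡0 (≤-trans (count-mono {p} {λ _ → false} (λ u → ⊥-elim ∘ none u))
                     (≤-reflexive (Σℕ.sum-replicate-zero n)))

  count-not : (p : Fin n → Bool) → count p + count (not ∘ p) ≡ n
  count-not p = begin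
    count p + count (not ∘ p)                           ≡⟨ Σℕ.∑-distrib-+ (indicator ∘ p) (indicator ∘ not ∘ p) ⟨
    sum (λ u → indicator (p u) + indicator (not (p u))) ≡⟨ Σℕ.sum-cong-≗ (indicator-not ∘ p) ⟩
    count {n} (λ _ → true)                              ≡⟨ count-true n ⟩
    n                                                   ∎
    where open ≡-Reasoning

count-point : ∀ {n} (p : Fin n → Bool) x → (∀ u → T (p u) → u ≡ x) → count p ≤ indicator (p x)
count-point {suc n} p zero only = begin
  indicator (p zero) + count (p ∘ suc)
    ≡⟨ cong (indicator (p zero) +_) (count-none (p ∘ suc) (λ u → suc≢zero ∘ only (suc u))) ⟩
  indicator (p zero) + 0
    ≡⟨ +-identityʳ _ ⟩
  indicator (p zero) ∎
  where
  open ≤-Reasoning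
  suc≢zero : ∀ {u : Fin n} → suc u ≢ zero
  suc≢zero ()
count-point {suc n} p (suc x) only with p zero in p-zero
... | true  = case only zero (subst T (sym p-zero) _) of λ ()
... | false = count-point (p ∘ suc) x (λ u → Fin.suc-injective ∘ only (suc u))

module _ {n : ℕ} where

  count-at : (p : Fin n → Bool) (x : Fin n) → count (λ u → p u ∧ (u ≡ᵇ x)) ≤ indicator (p x)
  count-at p x = ≤-trans (count-point _ x (λ u → ≡ᵇ-sound ∘ proj₂ ∘ T-∧⁻ {p u}))
                         (indicator-mono (proj₁ ∘ T-∧⁻ {p x}))

  count-cover : (p q r : Fin n → Bool) → (∀ u → T (p u) → T (q u) ⊎ T (r u)) → count p ≤ count q + count r
  count-cover p q r cover = ≤-trans (count-mono (λ u → Equivalence.from T-∨ ∘ cover u)) (count-∨ q r)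

  count-cover-at : (p q : Fin n → Bool) (x : Fin n) → (∀ u → T (p u) → T (q u) ⊎ u ≡ x) →
                   count p ≤ count q + indicator (p x)
  count-cover-at p q x cover =
    ≤-trans (count-cover p q (λ u → p u ∧ (u ≡ᵇ x)) (λ u pu → Sum.map₂ (at pu) (cover u pu)))
            (+-monoʳ-≤ (count q) (count-at p x))
    where
    at : ∀ {u} → T (p u) → u ≡ x → T (p u ∧ (u ≡ᵇ x))
    at pu refl = T-∧⁺ pu (≡ᵇ-refl x)

  count-cover-at₂ : (p q : Fin n → Bool) (x y : Fin n) → (∀ u → T (p u) → T (q u) ⊎ u ≡ x ⊎ u ≡ y) →
                    count p ≤ count q + indicator (p x) + indicator (p y)
  count-cover-at₂ p q x y cover =
    ≤-trans (count-cover-at p (λ u → q u ∨ (p u ∧ (u ≡ᵇ x))) y (λ u pu → regroup pu (cover u pu)))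
            (+-monoˡ-≤ (indicator (p y)) (≤-trans (count-∨ q _) (+-monoʳ-≤ (count q) (count-at p x))))
    where
    regroup : ∀ {u} → T (p u) → T (q u) ⊎ u ≡ x ⊎ u ≡ y → T (q u ∨ (p u ∧ (u ≡ᵇ x))) ⊎ u ≡ y
    regroup pu (inj₁ qu)          = inj₁ (Equivalence.from T-∨ (inj₁ qu))
    regroup pu (inj₂ (inj₁ refl)) = inj₁ (Equivalence.from T-∨ (inj₂ (T-∧⁺ pu (≡ᵇ-refl x))))
    regroup pu (inj₂ (inj₂ u≡y))  = inj₂ u≡y

count-tabulate : ∀ {a p} {A : Set a} {P : Pred A p} (P? : Decidable P) {n} (f : Fin n → A) →
                 Vec.count P? (tabulate f) ≡ count (does ∘ P? ∘ f)
count-tabulate P? {zero}  f = refl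
count-tabulate P? {suc n} f with does (P? (f zero))
... | true  = cong suc (count-tabulate P? (f ∘ suc))
... | false = count-tabulate P? (f ∘ suc)

-- Arithmetic

interior-split : ∀ {a k b} → a < k → k < b → b ∸ suc a ≡ (k ∸ suc a) + (b ∸ suc k) + 1
interior-split {a} {k} {b} a<k k<b = begin
  b ∸ suc a                  ≡⟨ cong (_∸ suc a) reassemble ⟨
  x + y + 1 + suc a ∸ suc a  ≡⟨ m+n∸n≡m (x + y + 1) (suc a) ⟩
  x + y + 1                  ∎
  where
  open ≡-Reasoning
  x = k ∸ suc a
  y = b ∸ suc k
  shuffle : ∀ x y z → x + y + 1 + z ≡ y + suc (x + z)
  shuffle = solve-∀
  reassemble : x + y + 1 + suc a ≡ b
  reassemble = begin
    x + y + 1 + suc a    ≡⟨ shuffle x y (suc a) ⟩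
    y + suc (x + suc a)  ≡⟨ cong (λ z → y + suc z) (m∸n+n≡m a<k) ⟩
    y + suc k            ≡⟨ m∸n+n≡m k<b ⟩
    b                    ∎

join-cost : ∀ {c c₁ c₂ m₁ m₂ β₁ β₂ β} d → c ≤ c₁ + c₂ + d →
            3 * c₁ + 4 ≤ m₁ + β₁ → 3 * c₂ + 4 ≤ m₂ + β₂ → β₁ + β₂ + 3 * d ≤ β + 5 →
            3 * c + 4 ≤ m₁ + m₂ + 1 + β
join-cost {c} {c₁} {c₂} {m₁} {m₂} {β₁} {β₂} {β} d c≤ cost₁ cost₂ fit = +-cancelˡ-≤ 4 _ _ (begin
  4 + (3 * c + 4)                          ≤⟨ +-monoʳ-≤ 4 (+-monoˡ-≤ 4 (*-monoʳ-≤ 3 c≤)) ⟩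
  4 + (3 * (c₁ + c₂ + d) + 4)              ≡⟨ regroup₁ c₁ c₂ d ⟩
  (3 * c₁ + 4) + (3 * c₂ + 4) + 3 * d      ≤⟨ +-monoˡ-≤ (3 * d) (+-mono-≤ cost₁ cost₂) ⟩
  (m₁ + β₁) + (m₂ + β₂) + 3 * d            ≡⟨ regroup₂ m₁ m₂ β₁ β₂ (3 * d) ⟩
  m₁ + m₂ + (β₁ + β₂ + 3 * d)              ≤⟨ +-monoʳ-≤ (m₁ + m₂) fit ⟩
  m₁ + m₂ + (β + 5)                        ≡⟨ regroup₃ m₁ m₂ β ⟩
  4 + (m₁ + m₂ + 1 + β)                    ∎)
  where
  open ≤-Reasoning
  regroup₁ : ∀ c₁ c₂ d → 4 + (3 * (c₁ + c₂ + d) + 4) ≡ (3 * c₁ + 4) + (3 * c₂ + 4) + 3 * d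
  regroup₁ = solve-∀
  regroup₂ : ∀ m₁ m₂ β₁ β₂ e → (m₁ + β₁) + (m₂ + β₂) + e ≡ m₁ + m₂ + (β₁ + β₂ + e)
  regroup₂ = solve-∀
  regroup₃ : ∀ m₁ m₂ β → m₁ + m₂ + (β + 5) ≡ 4 + (m₁ + m₂ + 1 + β)
  regroup₃ = solve-∀

root-cost : ∀ {c c₀ m β d} → c ≤ c₀ + d → 3 * c₀ + 4 ≤ m + β → β + 3 * d ≤ 6 → 3 * c ≤ m + 2
root-cost {c} {c₀} {m} {β} {d} c≤ cost₀ fit = +-cancelˡ-≤ 4 _ _ (begin
  4 + 3 * c                  ≤⟨ +-monoʳ-≤ 4 (*-monoʳ-≤ 3 c≤) ⟩
  4 + 3 * (c₀ + d)           ≡⟨ regroup₁ c₀ d ⟩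
  (3 * c₀ + 4) + 3 * d       ≤⟨ +-monoˡ-≤ (3 * d) cost₀ ⟩
  (m + β) + 3 * d            ≡⟨ +-assoc m β (3 * d) ⟩
  m + (β + 3 * d)            ≤⟨ +-monoʳ-≤ m fit ⟩
  m + 6                      ≡⟨ regroup₂ m ⟩
  4 + (m + 2)                ∎)
  where
  open ≤-Reasoning
  regroup₁ : ∀ c₀ d → 4 + 3 * (c₀ + d) ≡ (3 * c₀ + 4) + 3 * d
  regroup₁ = solve-∀
  regroup₂ : ∀ m → m + 6 ≡ 4 + (m + 2)
  regroup₂ = solve-∀

3d≤n⇒2n≤3k : ∀ {d k n} → d + k ≡ n → 3 * d ≤ n → 2 * n ≤ 3 * k
3d≤n⇒2n≤3k {d} {k} {n} d+k≡n 3d≤n = +-cancelˡ-≤ (3 * d) _ _ (begin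
  3 * d + 2 * n    ≤⟨ +-monoˡ-≤ (2 * n) 3d≤n ⟩
  n + 2 * n        ≡⟨ regroup n ⟩
  3 * n            ≡⟨ cong (3 *_) d+k≡n ⟨
  3 * (d + k)      ≡⟨ *-distribˡ-+ 3 d k ⟩
  3 * d + 3 * k    ∎)
  where
  open ≤-Reasoning
  regroup : ∀ n → n + 2 * n ≡ 3 * n
  regroup = solve-∀

-- Exhaustive Boolean checks

record Enumeration (A : Set) : Set where
  field
    elements : List A
    complete : ∀ x → x ∈ elements
open Enumeration

every-sound : ∀ {A} (e : Enumeration A) (p : A → Bool) → T (all p (elements e)) → ∀ x → T (p x)
every-sound e p holds x = All.lookup (all⁺ p (elements e) holds) (complete e x)

infixr 2 _⊗_
_⊗_ : ∀ {A B} → Enumeration A → Enumeration B → Enumeration (A × B)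
eA ⊗ eB = record
  { elements = cartesianProduct (elements eA) (elements eB)
  ; complete = λ (x , y) → ∈-cartesianProduct⁺ (complete eA x) (complete eB y)
  }

whenJust : ∀ {A : Set} → (A → Bool) → Maybe A → Bool
whenJust p (just x) = p x
whenJust p nothing  = true

whenJust-sound : ∀ {A : Set} (p : A → Bool) {m x} → T (whenJust p m) → m ≡ just x → T (p x)
whenJust-sound p holds refl = holds

-- Endpoint states and profiles

data State : Set where
  deleted : State
  kept    : (budget : Fin 3) → State

states : Enumeration State
states = record { elements = deleted ∷ List.map kept (allFin 3) ; complete = complete-states }
  where
  complete-states : ∀ s → s ∈ deleted ∷ List.map kept (allFin 3)
  complete-states deleted  = here refl
  complete-states (kept j) = there (∈-map⁺ kept (∈-allFin j))

isDeleted : State → Bool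
isDeleted deleted  = true
isDeleted (kept _) = false

keptCount : State → ℕ
keptCount s = indicator (not (isDeleted s))

Allows : State → ℕ → Set
Allows deleted  _ = ⊤
Allows (kept j) c = c ≤ toℕ j

Allows-anti : ∀ s {c c′} → c ≤ c′ → Allows s c′ → Allows s c
Allows-anti deleted  _    _  = tt
Allows-anti (kept j) c≤c′ ok = ≤-trans c≤c′ ok

Allows-zero : ∀ s → Allows s 0
Allows-zero deleted  = tt
Allows-zero (kept j) = z≤n

Allows⇒≤2 : ∀ s {c} → Allows s c → isDeleted s ≡ false → c ≤ 2
Allows⇒≤2 (kept j) c≤j _ = ≤-trans c≤j (Fin.toℕ≤pred[n] j)

-- Keeping the splitting vertex, a possible neighbour of the endpoint, uses one unit of its budget.
spend : State → Maybe State
spend deleted   = just deleted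
spend (kept 0F) = nothing
spend (kept 1F) = just (kept 0F)
spend (kept 2F) = just (kept 1F)

spend-Allows : ∀ {s s′ c} → spend s ≡ just s′ → Allows s′ c → Allows s (c + 1)
spend-Allows {deleted}         refl _  = tt
spend-Allows {kept 1F} {c = c} refl ok = ≤-trans (≤-reflexive (+-comm c 1)) (s≤s ok)
spend-Allows {kept 2F} {c = c} refl ok = ≤-trans (≤-reflexive (+-comm c 1)) (s≤s ok)

spend-isDeleted : ∀ {s s′} → spend s ≡ just s′ → isDeleted s′ ≡ isDeleted s
spend-isDeleted {deleted} refl = refl
spend-isDeleted {kept 1F} refl = refl
spend-isDeleted {kept 2F} refl = refl

Profile : Set
Profile = Fin 8

profiles : Enumeration Profile
profiles = record { elements = allFin 8 ; complete = ∈-allFin }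

bound : Profile → State → State → Maybe ℕ
bound 0F deleted   deleted   = just 4
bound 0F deleted   (kept 0F) = just 4
bound 0F deleted   (kept 1F) = just 4
bound 0F deleted   (kept 2F) = just 4
bound 0F (kept 0F) deleted   = just 4
bound 0F (kept 0F) (kept 0F) = just 4
bound 0F (kept 0F) (kept 1F) = just 4
bound 0F (kept 1F) deleted   = just 4
bound 0F (kept 1F) (kept 0F) = just 4
bound 0F (kept 2F) deleted   = just 4
bound 0F (kept 2F) (kept 2F) = just 6
bound 1F deleted   deleted   = just 3
bound 1F deleted   (kept 1F) = just 3
bound 1F deleted   (kept 2F) = just 3
bound 1F (kept 1F) deleted   = just 3
bound 1F (kept 1F) (kept 1F) = just 4
bound 1F (kept 1F) (kept 2F) = just 3
bound 1F (kept 2F) deleted   = just 3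
bound 1F (kept 2F) (kept 1F) = just 3
bound 2F deleted   deleted   = just 2
bound 2F (kept 0F) deleted   = just 2
bound 2F (kept 1F) deleted   = just 2
bound 2F (kept 2F) deleted   = just 2
bound 3F deleted   deleted   = just 0
bound 4F deleted   deleted   = just 2
bound 4F deleted   (kept 0F) = just 2
bound 4F deleted   (kept 1F) = just 2
bound 4F deleted   (kept 2F) = just 2
bound 5F deleted   deleted   = just 1
bound 5F (kept 1F) deleted   = just 1
bound 5F (kept 2F) deleted   = just 1
bound 6F deleted   deleted   = just 1
bound 6F deleted   (kept 1F) = just 1
bound 6F deleted   (kept 2F) = just 1
bound 7F deleted   deleted   = just 2
bound 7F deleted   (kept 2F) = just 2
bound 7F (kept 2F) deleted   = just 2
bound _  _         _         = nothing

bound-0F≥4 : ∀ sa sb {β} → bound 0F sa sb ≡ just β → 4 ≤ β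
bound-0F≥4 sa sb eq =
  ≤ᵇ⇒≤ 4 _ (whenJust-sound (4 ≤ᵇ_) (every-sound (states ⊗ states) at-least-4 _ (sa , sb)) eq)
  where
  at-least-4 : State × State → Bool
  at-least-4 (sa , sb) = whenJust (4 ≤ᵇ_) (bound 0F sa sb)

_⊕_ : Profile → Profile → Profile
t₁ ⊕ t₂ = Vec.lookup (Vec.lookup table t₁) t₂
  where
  table : Vec (Vec Profile 8) 8
  table = (1F ∷ 7F ∷ 5F ∷ 2F ∷ 0F ∷ 3F ∷ 1F ∷ 5F ∷ [])
        ∷ (7F ∷ 7F ∷ 3F ∷ 5F ∷ 1F ∷ 3F ∷ 1F ∷ 3F ∷ [])
        ∷ (0F ∷ 1F ∷ 2F ∷ 2F ∷ 0F ∷ 2F ∷ 1F ∷ 2F ∷ [])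
        ∷ (4F ∷ 6F ∷ 3F ∷ 3F ∷ 3F ∷ 3F ∷ 3F ∷ 3F ∷ [])
        ∷ (6F ∷ 3F ∷ 3F ∷ 3F ∷ 4F ∷ 3F ∷ 6F ∷ 3F ∷ [])
        ∷ (1F ∷ 1F ∷ 5F ∷ 3F ∷ 1F ∷ 3F ∷ 1F ∷ 5F ∷ [])
        ∷ (3F ∷ 3F ∷ 3F ∷ 3F ∷ 4F ∷ 3F ∷ 3F ∷ 3F ∷ [])
        ∷ (6F ∷ 3F ∷ 3F ∷ 3F ∷ 4F ∷ 3F ∷ 6F ∷ 7F ∷ [])
        ∷ []

-- The constants 2 and 5 are those of join-cost for d = 1 (k deleted) and d = 0.
data Justified (t₁ t₂ : Profile) (sa sb : State) (β : ℕ) : Set where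
  by-deleting : ∀ {β₁ β₂} → bound t₁ sa deleted ≡ just β₁ → bound t₂ deleted sb ≡ just β₂ →
                β₁ + β₂ ≤ β + 2 → Justified t₁ t₂ sa sb β
  by-keeping  : ∀ {sa′ sb′ j₁ j₂ β₁ β₂} → spend sa ≡ just sa′ → spend sb ≡ just sb′ →
                keptCount sa + keptCount sb + toℕ j₁ + toℕ j₂ ≤ 3 →
                bound t₁ sa′ (kept j₁) ≡ just β₁ → bound t₂ (kept j₂) sb′ ≡ just β₂ →
                β₁ + β₂ ≤ β + 5 → Justified t₁ t₂ sa sb β

data Choice : Set where
  delete : Choice
  keep   : (j₁ j₂ : Fin 3) → Choice

choices : List Choice
choices = delete ∷ cartesianProductWith keep (allFin 3) (allFin 3)

fits : Maybe ℕ → Maybe ℕ → ℕ → Bool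
fits (just β₁) (just β₂) β = β₁ + β₂ ≤ᵇ β
fits _         _         _ = false

fits-sound : ∀ x y β → T (fits x y β) → ∃₂ λ β₁ β₂ → x ≡ just β₁ × y ≡ just β₂ × β₁ + β₂ ≤ β
fits-sound (just β₁) (just β₂) β h = β₁ , β₂ , refl , refl , ≤ᵇ⇒≤ _ _ h

justifies : Profile → Profile → State → State → ℕ → Choice → Bool
justifies t₁ t₂ sa sb β delete = fits (bound t₁ sa deleted) (bound t₂ deleted sb) (β + 2)
justifies t₁ t₂ sa sb β (keep j₁ j₂) with spend sa | spend sb
... | just sa′ | just sb′ = (keptCount sa + keptCount sb + toℕ j₁ + toℕ j₂ ≤ᵇ 3)
                            ∧ fits (bound t₁ sa′ (kept j₁)) (bound t₂ (kept j₂) sb′) (β + 5)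
... | _        | _        = false

justifies-sound : ∀ t₁ t₂ sa sb β c → T (justifies t₁ t₂ sa sb β c) → Justified t₁ t₂ sa sb β
justifies-sound t₁ t₂ sa sb β delete h =
  let _ , _ , e₁ , e₂ , fit = fits-sound _ _ _ h in by-deleting e₁ e₂ fit
justifies-sound t₁ t₂ sa sb β (keep j₁ j₂) h with spend sa in ea | spend sb in eb
... | just sa′ | just sb′ =
  let degree-ok , fit′ = T-∧⁻ h
      _ , _ , e₁ , e₂ , fit = fits-sound _ _ _ fit′
  in  by-keeping ea eb (≤ᵇ⇒≤ _ _ degree-ok) e₁ e₂ fit

entry-justified : Profile × Profile × State × State → Bool
entry-justified (t₁ , t₂ , sa , sb) =
  whenJust (λ β → any (justifies t₁ t₂ sa sb β) choices) (bound (t₁ ⊕ t₂) sa sb)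

⊕-justified : ∀ t₁ t₂ sa sb {β} → bound (t₁ ⊕ t₂) sa sb ≡ just β → Justified t₁ t₂ sa sb β
⊕-justified t₁ t₂ sa sb {β} eq =
  let entry  = every-sound (profiles ⊗ profiles ⊗ states ⊗ states) entry-justified _ (t₁ , t₂ , sa , sb)
      c , ok = satisfied (any⁻ (justifies t₁ t₂ sa sb β) choices
                         (whenJust-sound (λ β → any (justifies t₁ t₂ sa sb β) choices) entry eq))
  in  justifies-sound t₁ t₂ sa sb β c ok

RootChoice : Profile → Set
RootChoice t = ∃₂ λ sa sb → ∃ λ β →
  bound t sa sb ≡ just β × β + 3 * (indicator (isDeleted sa) + indicator (isDeleted sb)) ≤ 6

root-choice : ∀ t → RootChoice t
root-choice 0F = kept 2F , kept 2F , 6 , refl , ≤ᵇ⇒≤ _ _ _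
root-choice 1F = deleted , kept 2F , 3 , refl , ≤ᵇ⇒≤ _ _ _
root-choice 2F = kept 2F , deleted , 2 , refl , ≤ᵇ⇒≤ _ _ _
root-choice 3F = deleted , deleted , 0 , refl , ≤ᵇ⇒≤ _ _ _
root-choice 4F = deleted , kept 2F , 2 , refl , ≤ᵇ⇒≤ _ _ _
root-choice 5F = kept 2F , deleted , 1 , refl , ≤ᵇ⇒≤ _ _ _
root-choice 6F = deleted , kept 2F , 1 , refl , ≤ᵇ⇒≤ _ _ _
root-choice 7F = deleted , kept 2F , 2 , refl , ≤ᵇ⇒≤ _ _ _

-- Noncrossing chord diagrams

least : ∀ {n p} {P : Pred (Fin n) p} → Decidable P → ∀ {w} → P w →
        ∃ λ k → P k × (∀ {v} → v Fin.< k → ¬ P v)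
least {n} {P = P} P? {w} Pw =
  let k , ¬¬Pk , below = Fin.¬∀⟶∃¬-smallest n (¬_ ∘ P) (¬? ∘ P?) (λ all¬P → all¬P w Pw)
  in  k , decidable-stable (P? k) ¬¬Pk , λ v<k → subst (¬_ ∘ P) (inject-fromℕ< v<k) (below (Fin.fromℕ< v<k))
  where
  inject-fromℕ< : ∀ {k v : Fin n} (v<k : v Fin.< k) → Fin.inject (Fin.fromℕ< v<k) ≡ v
  inject-fromℕ< v<k = Fin.toℕ-injective (trans (Fin.toℕ-inject _) (Fin.toℕ-fromℕ< v<k))

record NoncrossingDiagram (n : ℕ) : Set where
  field
    edge        : Fin n → Fin n → Bool
    edge-sym    : ∀ {u v} → T (edge u v) → T (edge v u)
    edge-irrefl : ∀ {v} → ¬ T (edge v v)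
    noncrossing : ∀ {p q r s} → T (edge p q) → T (edge r s) → ¬ (p Fin.< r × r Fin.< q × q Fin.< s)

keptNeighbour : ∀ {n} → (Fin n → Fin n → Bool) → (Fin n → Bool) → Fin n → Fin n → Bool
keptNeighbour E Z v u = not (Z u) ∧ E v u

keptDegree : ∀ {n} → (Fin n → Fin n → Bool) → (Fin n → Bool) → Fin n → ℕ
keptDegree E Z v = count (keptNeighbour E Z v)

record Inside {n} (a b v : Fin n) : Set where
  constructor between
  field
    lower : a Fin.< v
    upper : v Fin.< b

insideᵇ : ∀ {n} → Fin n → Fin n → Fin n → Bool
insideᵇ a b v = (toℕ a <ᵇ toℕ v) ∧ (toℕ v <ᵇ toℕ b)

insideᵇ-sound : ∀ {n} (a b v : Fin n) → T (insideᵇ a b v) → Inside a b v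
insideᵇ-sound a b v inside = let a<v , v<b = T-∧⁻ inside in between (<ᵇ⇒< _ _ a<v) (<ᵇ⇒< _ _ v<b)

insideᵇ-complete : ∀ {n} {a b v : Fin n} → Inside a b v → T (insideᵇ a b v)
insideᵇ-complete (between a<v v<b) = T-∧⁺ (<⇒<ᵇ a<v) (<⇒<ᵇ v<b)

module _ {n : ℕ} where

  Inside-irreflˡ : ∀ {a b : Fin n} → ¬ Inside a b a
  Inside-irreflˡ (between a<a _) = <-irrefl refl a<a

  Inside-irreflʳ : ∀ {a b : Fin n} → ¬ Inside a b b
  Inside-irreflʳ (between _ b<b) = <-irrefl refl b<b

  Inside-or-end : ∀ {a b u : Fin n} → a Fin.≤ u → u Fin.≤ b → u ≡ a ⊎ Inside a b u ⊎ u ≡ b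
  Inside-or-end a≤u u≤b with m≤n⇒m<n∨m≡n a≤u | m≤n⇒m<n∨m≡n u≤b
  ... | inj₂ a≡u | _        = inj₁ (Fin.toℕ-injective (sym a≡u))
  ... | inj₁ _   | inj₂ u≡b = inj₂ (inj₂ (Fin.toℕ-injective u≡b))
  ... | inj₁ a<u | inj₁ u<b = inj₂ (inj₁ (between a<u u<b))

  Inside-split : ∀ {a b v} (k : Fin n) → Inside a b v → Inside a k v ⊎ v ≡ k ⊎ Inside k b v
  Inside-split {v = v} k (between a<v v<b) with <-cmp (toℕ v) (toℕ k)
  ... | tri< v<k _ _ = inj₁ (between a<v v<k)
  ... | tri≈ _ v≡k _ = inj₂ (inj₁ (Fin.toℕ-injective v≡k))
  ... | tri> _ _ k<v = inj₂ (inj₂ (between k<v v<b))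

  Supported : (Fin n → Bool) → Fin n → Fin n → Set
  Supported X a b = ∀ {v} → T (X v) → Inside a b v

  outside : ∀ {X a b v} → Supported X a b → ¬ Inside a b v → X v ≡ false
  outside supported v∉ = ¬T⇒≡false (v∉ ∘ supported)

module _ {n : ℕ} (D : NoncrossingDiagram n) where
  open NoncrossingDiagram D

  Closed : Fin n → Fin n → Set
  Closed a b = ∀ {v u} → Inside a b v → T (edge v u) → a Fin.≤ u × u Fin.≤ b

  keptNeighboursIn : Fin n → Fin n → (Fin n → Bool) → Fin n → ℕ
  keptNeighboursIn a b Z v = count (λ u → insideᵇ a b u ∧ keptNeighbour edge Z v u)

  record Extends (a b : Fin n) (sa sb : State) (X Z : Fin n → Bool) : Set where
    field
      on-inside : ∀ {v} → Inside a b v → Z v ≡ X v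
      at-left   : Z a ≡ isDeleted sa
      at-right  : Z b ≡ isDeleted sb

  record Valid (a b : Fin n) (sa sb : State) (Z : Fin n → Bool) : Set where
    field
      inner-degree : ∀ {v} → Inside a b v → Z v ≡ false → keptDegree edge Z v ≤ 3
      left-budget  : Allows sa (keptNeighboursIn a b Z a)
      right-budget : Allows sb (keptNeighboursIn a b Z b)

  interiorSize : Fin n → Fin n → ℕ
  interiorSize a b = toℕ b ∸ suc (toℕ a)

  record Solution (a b : Fin n) (sa sb : State) (β : ℕ) : Set where
    field
      X         : Fin n → Bool
      supported : Supported X a b
      cost      : 3 * count X + 4 ≤ interiorSize a b + β
      -- Quantifying over all extensions Z lets solutions of [a, k] and [k, b] be joined
      -- without showing that validity depends only on the vertices in [a, b].
      valid     : ∀ {Z} → Extends a b sa sb X Z → Valid a b sa sb Z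

  Realizes : Profile → Fin n → Fin n → Set
  Realizes t a b = ∀ {sa sb β} → bound t sa sb ≡ just β → Solution a b sa sb β

  keptDegree-within : ∀ {a b v} Z → (∀ {u} → T (edge v u) → a Fin.≤ u × u Fin.≤ b) →
                      keptDegree edge Z v ≤ keptNeighboursIn a b Z v
                        + indicator (keptNeighbour edge Z v a) + indicator (keptNeighbour edge Z v b)
  keptDegree-within {a} {b} {v} Z spans = count-cover-at₂ _ _ a b cover
    where
    cover : ∀ u → T (keptNeighbour edge Z v u) →
            T (insideᵇ a b u ∧ keptNeighbour edge Z v u) ⊎ u ≡ a ⊎ u ≡ b
    cover u vu with a≤u , u≤b ← spans (proj₂ (T-∧⁻ vu))
                 | Inside-or-end a≤u u≤b
    ... | inj₁ u≡a             = inj₂ (inj₁ u≡a)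
    ... | inj₂ (inj₁ u-inside) = inj₁ (T-∧⁺ (insideᵇ-complete u-inside) vu)
    ... | inj₂ (inj₂ u≡b)      = inj₂ (inj₂ u≡b)

  [kept]≤keptCount : ∀ Z v {x s} → Z x ≡ isDeleted s → indicator (keptNeighbour edge Z v x) ≤ keptCount s
  [kept]≤keptCount Z v {x} Zx≡ =
    ≤-trans (indicator-mono (proj₁ ∘ T-∧⁻ {not (Z x)})) (≤-reflexive (cong (indicator ∘ not) Zx≡))

  [inside-kept]≤[not-deleted] : ∀ a b Z v x →
    indicator (insideᵇ a b x ∧ keptNeighbour edge Z v x) ≤ indicator (not (Z x))
  [inside-kept]≤[not-deleted] a b Z v x =
    indicator-mono (proj₁ ∘ T-∧⁻ {not (Z x)} ∘ proj₂ ∘ T-∧⁻ {insideᵇ a b x})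

  [kept-self]≤0 : ∀ Z v → indicator (keptNeighbour edge Z v v) ≤ 0
  [kept-self]≤0 Z v = indicator-mono {y = false} (edge-irrefl ∘ proj₂ ∘ T-∧⁻ {not (Z v)})

  adjacent-realizes : ∀ {a b} → toℕ b ≡ suc (toℕ a) → Realizes 0F a b
  adjacent-realizes {a} {b} b≡1+a {sa} {sb} {β} eq = record
    { X         = λ _ → false
    ; supported = λ ()
    ; cost      = cost
    ; valid     = λ {Z} _ → record
      { inner-degree = ⊥-elim ∘ empty
      ; left-budget  = subst (Allows sa) (sym (no-neighbours Z a)) (Allows-zero sa)
      ; right-budget = subst (Allows sb) (sym (no-neighbours Z b)) (Allows-zero sb)
      }
    }
    where
    empty : ∀ {v} → ¬ Inside a b v
    empty (between a<v v<b) = <⇒≱ a<v (≤-pred (subst (_ <_) b≡1+a v<b))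
    no-neighbours : ∀ Z x → keptNeighboursIn a b Z x ≡ 0
    no-neighbours Z x = count-none _ (λ u → empty ∘ insideᵇ-sound a b u ∘ proj₁ ∘ T-∧⁻)
    no-interior : interiorSize a b ≡ 0
    no-interior = trans (cong (_∸ suc (toℕ a)) b≡1+a) (n∸n≡0 (suc (toℕ a)))
    cost : 3 * count {n} (λ _ → false) + 4 ≤ interiorSize a b + β
    cost = begin
      3 * count {n} (λ _ → false) + 4  ≡⟨ cong (λ c → 3 * c + 4) (count-none {n} (λ _ → false) (λ _ ())) ⟩
      4                                ≤⟨ bound-0F≥4 sa sb eq ⟩
      β                                ≡⟨ cong (_+ β) no-interior ⟨
      interiorSize a b + β             ∎
      where open ≤-Reasoning

  module Join {a k b : Fin n} (a<k : a Fin.< k) (k<b : k Fin.< b)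
              (closed : Closed a b) (closed₁ : Closed a k) (closed₂ : Closed k b) where

    widenˡ : ∀ {v} → Inside a k v → Inside a b v
    widenˡ (between a<v v<k) = between a<v (<-trans v<k k<b)

    widenʳ : ∀ {v} → Inside k b v → Inside a b v
    widenʳ (between k<v v<b) = between (<-trans a<k k<v) v<b

    k-inside : Inside a b k
    k-inside = between a<k k<b

    left-neighbours : ∀ Z → keptNeighboursIn a b Z a ≤ keptNeighboursIn a k Z a + indicator (not (Z k))
    left-neighbours Z =
      ≤-trans (count-cover-at _ _ k cover) (+-monoʳ-≤ _ ([inside-kept]≤[not-deleted] a b Z a k))
      where
      cover : ∀ u → T (insideᵇ a b u ∧ keptNeighbour edge Z a u) →
              T (insideᵇ a k u ∧ keptNeighbour edge Z a u) ⊎ u ≡ k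
      cover u h with u-inside , au ← T-∧⁻ h | Inside-split k (insideᵇ-sound a b u u-inside)
      ... | inj₁ u∈₁        = inj₁ (T-∧⁺ (insideᵇ-complete u∈₁) au)
      ... | inj₂ (inj₁ u≡k) = inj₂ u≡k
      ... | inj₂ (inj₂ u∈₂) = ⊥-elim (<⇒≱ a<k (proj₁ (closed₂ u∈₂ (edge-sym (proj₂ (T-∧⁻ au))))))

    right-neighbours : ∀ Z → keptNeighboursIn a b Z b ≤ keptNeighboursIn k b Z b + indicator (not (Z k))
    right-neighbours Z =
      ≤-trans (count-cover-at _ _ k cover) (+-monoʳ-≤ _ ([inside-kept]≤[not-deleted] a b Z b k))
      where
      cover : ∀ u → T (insideᵇ a b u ∧ keptNeighbour edge Z b u) →
              T (insideᵇ k b u ∧ keptNeighbour edge Z b u) ⊎ u ≡ k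
      cover u h with u-inside , bu ← T-∧⁻ h | Inside-split k (insideᵇ-sound a b u u-inside)
      ... | inj₁ u∈₁        = ⊥-elim (<⇒≱ k<b (proj₂ (closed₁ u∈₁ (edge-sym (proj₂ (T-∧⁻ bu))))))
      ... | inj₂ (inj₁ u≡k) = inj₂ u≡k
      ... | inj₂ (inj₂ u∈₂) = inj₁ (T-∧⁺ (insideᵇ-complete u∈₂) bu)

    k-neighbours : ∀ Z → keptNeighboursIn a b Z k ≤ keptNeighboursIn a k Z k + keptNeighboursIn k b Z k
    k-neighbours Z = count-cover _ _ _ cover
      where
      cover : ∀ u → T (insideᵇ a b u ∧ keptNeighbour edge Z k u) →
              T (insideᵇ a k u ∧ keptNeighbour edge Z k u) ⊎ T (insideᵇ k b u ∧ keptNeighbour edge Z k u)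
      cover u h with u-inside , ku ← T-∧⁻ h | Inside-split k (insideᵇ-sound a b u u-inside)
      ... | inj₁ u∈₁         = inj₁ (T-∧⁺ (insideᵇ-complete u∈₁) ku)
      ... | inj₂ (inj₁ refl) = ⊥-elim (edge-irrefl (proj₂ (T-∧⁻ ku)))
      ... | inj₂ (inj₂ u∈₂)  = inj₂ (T-∧⁺ (insideᵇ-complete u∈₂) ku)

    k-degree : ∀ {Z sa sb} → Z a ≡ isDeleted sa → Z b ≡ isDeleted sb →
               keptDegree edge Z k ≤ keptNeighboursIn a k Z k + keptNeighboursIn k b Z k + keptCount sa + keptCount sb
    k-degree {Z} Za Zb = ≤-trans (keptDegree-within Z (closed k-inside))
      (+-mono-≤ (+-mono-≤ (k-neighbours Z) ([kept]≤keptCount Z k Za)) ([kept]≤keptCount Z k Zb))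

    record ValidAtJoin (sa sb : State) (Z : Fin n → Bool) : Set where
      field
        k-degree≤3   : Z k ≡ false → keptDegree edge Z k ≤ 3
        left-budget  : Allows sa (keptNeighboursIn a b Z a)
        right-budget : Allows sb (keptNeighboursIn a b Z b)

    join : ∀ {sa sb sa₁ sk₁ sk₂ sb₂ β₁ β₂ β} →
           isDeleted sa₁ ≡ isDeleted sa → isDeleted sk₂ ≡ isDeleted sk₁ → isDeleted sb₂ ≡ isDeleted sb →
           β₁ + β₂ + 3 * indicator (isDeleted sk₁) ≤ β + 5 →
           (∀ {Z} → Z a ≡ isDeleted sa → Z b ≡ isDeleted sb → Z k ≡ isDeleted sk₁ →
              Valid a k sa₁ sk₁ Z → Valid k b sk₂ sb₂ Z → ValidAtJoin sa sb Z) →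
           Solution a k sa₁ sk₁ β₁ → Solution k b sk₂ sb₂ β₂ → Solution a b sa sb β
    join {sk₁ = sk₁} {β = β} ea ek eb fit at-join S₁ S₂ = record
      { X         = X
      ; supported = supported
      ; cost      = subst (λ m → 3 * count X + 4 ≤ m + β) (sym (interior-split a<k k<b))
                          (join-cost {c₁ = count S₁.X} {count S₂.X} {interiorSize a k} {interiorSize k b}
                                     (indicator dk) count-X S₁.cost S₂.cost fit)
      ; valid     = valid
      }
      where
      module S₁ = Solution S₁
      module S₂ = Solution S₂
      dk = isDeleted sk₁

      X : Fin n → Bool
      X u = S₁.X u ∨ S₂.X u ∨ (dk ∧ (u ≡ᵇ k))

      supported : Supported X a b
      supported Xv with Equivalence.to T-∨ Xv
      ... | inj₁ X₁v = widenˡ (S₁.supported X₁v)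
      ... | inj₂ rest with Equivalence.to T-∨ rest
      ...   | inj₁ X₂v = widenʳ (S₂.supported X₂v)
      ...   | inj₂ v≡k = subst (Inside a b) (sym (≡ᵇ-sound (proj₂ (T-∧⁻ {dk} v≡k)))) k-inside

      count-X : count X ≤ count S₁.X + count S₂.X + indicator dk
      count-X = begin
        count X                                                  ≤⟨ count-∨ S₁.X _ ⟩
        count S₁.X + count (λ u → S₂.X u ∨ (dk ∧ (u ≡ᵇ k)))      ≤⟨ +-monoʳ-≤ (count S₁.X) (count-∨ S₂.X _) ⟩
        count S₁.X + (count S₂.X + count (λ u → dk ∧ (u ≡ᵇ k)))  ≤⟨ +-monoʳ-≤ (count S₁.X) (+-monoʳ-≤ (count S₂.X)
                                                                                           (count-at (λ _ → dk) k)) ⟩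
        count S₁.X + (count S₂.X + indicator dk)                 ≡⟨ +-assoc (count S₁.X) _ _ ⟨
        count S₁.X + count S₂.X + indicator dk                   ∎
        where open ≤-Reasoning

      X-left : ∀ {v} → Inside a k v → X v ≡ S₁.X v
      X-left {v} (between _ v<k) = begin
        S₁.X v ∨ S₂.X v ∨ (dk ∧ (v ≡ᵇ k))  ≡⟨ cong₂ (λ x y → S₁.X v ∨ x ∨ (dk ∧ y))
                                                    (outside S₂.supported (<-asym v<k ∘ Inside.lower))
                                                    (≢⇒≡ᵇ-false {u = v} {k} λ { refl → <-irrefl refl v<k }) ⟩
        S₁.X v ∨ (dk ∧ false)              ≡⟨ cong (S₁.X v ∨_) (∧-zeroʳ dk) ⟩
        S₁.X v ∨ false                     ≡⟨ ∨-identityʳ (S₁.X v) ⟩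
        S₁.X v                             ∎
        where open ≡-Reasoning

      X-right : ∀ {v} → Inside k b v → X v ≡ S₂.X v
      X-right {v} (between k<v _) = begin
        S₁.X v ∨ S₂.X v ∨ (dk ∧ (v ≡ᵇ k))  ≡⟨ cong₂ (λ x y → x ∨ S₂.X v ∨ (dk ∧ y))
                                                    (outside S₁.supported (<-asym k<v ∘ Inside.upper))
                                                    (≢⇒≡ᵇ-false {u = v} {k} λ { refl → <-irrefl refl k<v }) ⟩
        S₂.X v ∨ (dk ∧ false)              ≡⟨ cong (S₂.X v ∨_) (∧-zeroʳ dk) ⟩
        S₂.X v ∨ false                     ≡⟨ ∨-identityʳ (S₂.X v) ⟩
        S₂.X v                             ∎
        where open ≡-Reasoning

      X-k : X k ≡ dk
      X-k = begin
        S₁.X k ∨ S₂.X k ∨ (dk ∧ (k ≡ᵇ k))  ≡⟨ cong₂ (λ x y → x ∨ y ∨ (dk ∧ (k ≡ᵇ k)))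
                                                    (outside S₁.supported Inside-irreflʳ)
                                                    (outside S₂.supported Inside-irreflˡ) ⟩
        dk ∧ (k ≡ᵇ k)                      ≡⟨ cong (dk ∧_) (Equivalence.to T-≡ (≡ᵇ-refl k)) ⟩
        dk ∧ true                          ≡⟨ ∧-identityʳ dk ⟩
        dk                                 ∎
        where open ≡-Reasoning

      valid : ∀ {Z} → Extends a b _ _ X Z → Valid a b _ _ Z
      valid {Z} ext = record
        { inner-degree = inner-degree
        ; left-budget  = ValidAtJoin.left-budget at-k
        ; right-budget = ValidAtJoin.right-budget at-k
        }
        where
        open Extends ext
        Zk : Z k ≡ dk
        Zk = trans (on-inside k-inside) X-k
        V₁ : Valid a k _ _ Z
        V₁ = S₁.valid record { on-inside = λ v∈ → trans (on-inside (widenˡ v∈)) (X-left v∈)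
                             ; at-left   = trans at-left (sym ea)
                             ; at-right  = Zk }
        V₂ : Valid k b _ _ Z
        V₂ = S₂.valid record { on-inside = λ v∈ → trans (on-inside (widenʳ v∈)) (X-right v∈)
                             ; at-left   = trans Zk (sym ek)
                             ; at-right  = trans at-right (sym eb) }
        at-k = at-join at-left at-right Zk V₁ V₂
        inner-degree : ∀ {v} → Inside a b v → Z v ≡ false → keptDegree edge Z v ≤ 3
        inner-degree v∈ Zv with Inside-split k v∈
        ... | inj₁ v∈₁         = Valid.inner-degree V₁ v∈₁ Zv
        ... | inj₂ (inj₁ refl) = ValidAtJoin.k-degree≤3 at-k Zv
        ... | inj₂ (inj₂ v∈₂)  = Valid.inner-degree V₂ v∈₂ Zv

    join-deleting : ∀ {sa sb β₁ β₂ β} → Solution a k sa deleted β₁ → Solution k b deleted sb β₂ →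
                    β₁ + β₂ ≤ β + 2 → Solution a b sa sb β
    join-deleting {sa} {sb} {β = β} S₁ S₂ fit =
      join refl refl refl (≤-trans (+-monoˡ-≤ 3 fit) (≤-reflexive (+-assoc β 2 3))) at-join S₁ S₂
      where
      at-join : ∀ {Z} → Z a ≡ isDeleted sa → Z b ≡ isDeleted sb → Z k ≡ true →
                Valid a k sa deleted Z → Valid k b deleted sb Z → ValidAtJoin sa sb Z
      at-join {Z} _ _ Zk V₁ V₂ = record
        { k-degree≤3   = λ Zk≡false → case trans (sym Zk) Zk≡false of λ ()
        ; left-budget  = Allows-anti sa (k-deleted (left-neighbours Z)) (Valid.left-budget V₁)
        ; right-budget = Allows-anti sb (k-deleted (right-neighbours Z)) (Valid.right-budget V₂)
        }
        where
        k-deleted : ∀ {c c′} → c ≤ c′ + indicator (not (Z k)) → c ≤ c′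
        k-deleted {c} {c′} c≤ = subst (c ≤_) (+-identityʳ c′) (subst (λ z → c ≤ c′ + indicator (not z)) Zk c≤)

    join-keeping : ∀ {sa sb sa′ sb′ j₁ j₂ β₁ β₂ β} → spend sa ≡ just sa′ → spend sb ≡ just sb′ →
                   keptCount sa + keptCount sb + toℕ j₁ + toℕ j₂ ≤ 3 →
                   Solution a k sa′ (kept j₁) β₁ → Solution k b (kept j₂) sb′ β₂ →
                   β₁ + β₂ ≤ β + 5 → Solution a b sa sb β
    join-keeping {sa} {sb} {sa′} {sb′} {j₁} {j₂} ea eb degree-ok S₁ S₂ fit =
      join (spend-isDeleted ea) refl (spend-isDeleted eb) (≤-trans (≤-reflexive (+-identityʳ _)) fit)
           at-join S₁ S₂
      where
      at-join : ∀ {Z} → Z a ≡ isDeleted sa → Z b ≡ isDeleted sb → Z k ≡ false →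
                Valid a k sa′ (kept j₁) Z → Valid k b (kept j₂) sb′ Z → ValidAtJoin sa sb Z
      at-join {Z} Za Zb Zk V₁ V₂ = record
        { k-degree≤3   = λ _ → k-degree≤3
        ; left-budget  = Allows-anti sa (k-kept (left-neighbours Z)) (spend-Allows ea (Valid.left-budget V₁))
        ; right-budget = Allows-anti sb (k-kept (right-neighbours Z)) (spend-Allows eb (Valid.right-budget V₂))
        }
        where
        k-kept : ∀ {c c′} → c ≤ c′ + indicator (not (Z k)) → c ≤ c′ + 1
        k-kept {c} {c′} = subst (λ z → c ≤ c′ + indicator (not z)) Zk
        k-degree≤3 : keptDegree edge Z k ≤ 3
        k-degree≤3 = begin
          keptDegree edge Z k
            ≤⟨ k-degree Za Zb ⟩
          keptNeighboursIn a k Z k + keptNeighboursIn k b Z k + keptCount sa + keptCount sb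
            ≤⟨ +-monoˡ-≤ _ (+-monoˡ-≤ _ (+-mono-≤ (Valid.right-budget V₁) (Valid.left-budget V₂))) ⟩
          toℕ j₁ + toℕ j₂ + keptCount sa + keptCount sb
            ≡⟨ regroup (toℕ j₁) (toℕ j₂) (keptCount sa) (keptCount sb) ⟩
          keptCount sa + keptCount sb + toℕ j₁ + toℕ j₂
            ≤⟨ degree-ok ⟩
          3 ∎
          where
          open ≤-Reasoning
          regroup : ∀ x y z w → x + y + z + w ≡ z + w + x + y
          regroup = solve-∀

    join-justified : ∀ {t₁ t₂ sa sb β} → Realizes t₁ a k → Realizes t₂ k b →
                     Justified t₁ t₂ sa sb β → Solution a b sa sb β
    join-justified R₁ R₂ (by-deleting e₁ e₂ fit) =
      join-deleting (R₁ e₁) (R₂ e₂) fit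
    join-justified R₁ R₂ (by-keeping ea eb degree-ok e₁ e₂ fit) =
      join-keeping ea eb degree-ok (R₁ e₁) (R₂ e₂) fit

    ⊕-realizes : ∀ {t₁ t₂} → Realizes t₁ a k → Realizes t₂ k b → Realizes (t₁ ⊕ t₂) a b
    ⊕-realizes {t₁} {t₂} R₁ R₂ {sa} {sb} eq = join-justified R₁ R₂ (⊕-justified t₁ t₂ sa sb eq)

  split : ∀ {a b} → a Fin.< b → toℕ b ≢ suc (toℕ a) → Closed a b →
          ∃ λ k → a Fin.< k × k Fin.< b × Closed a k × Closed k b
  split {a} {b} a<b b≢1+a closed = k , a<k , k<b , closed₁ , closed₂
    where
    Anchor : Fin n → Set
    Anchor v = Inside a b v × (T (edge v b) ⊎ suc (toℕ v) ≡ toℕ b)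

    anchor? : Decidable Anchor
    anchor? v = map′ (insideᵇ-sound a b v) insideᵇ-complete (T? (insideᵇ a b v))
                ×-dec (T? (edge v b) ⊎-dec (suc (toℕ v) ℕ.≟ toℕ b))

    b-1 : Fin n
    b-1 = Fin.fromℕ< (≤-<-trans pred[n]≤n (Fin.toℕ<n b))

    b-1-anchor : Anchor b-1
    b-1-anchor = between (subst (toℕ a <_) (sym b-1≡) a<b-1)
                         (subst (_< toℕ b) (sym b-1≡) (subst (ℕ.pred (toℕ b) <_) b-1+1≡b (n<1+n _)))
               , inj₂ (trans (cong suc b-1≡) b-1+1≡b)
      where
      b-1≡ : toℕ b-1 ≡ ℕ.pred (toℕ b)
      b-1≡ = Fin.toℕ-fromℕ< _
      b-1+1≡b : suc (ℕ.pred (toℕ b)) ≡ toℕ b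
      b-1+1≡b = suc-pred (toℕ b) {{>-nonZero (≤-<-trans z≤n a<b)}}
      a<b-1 : toℕ a < ℕ.pred (toℕ b)
      a<b-1 = ≤-pred (subst (suc (suc (toℕ a)) ≤_) (sym b-1+1≡b) (≤∧≢⇒< a<b (b≢1+a ∘ sym)))

    least-anchor = least anchor? b-1-anchor
    k = proj₁ least-anchor
    k-anchor = proj₁ (proj₂ least-anchor)
    below-k = proj₂ (proj₂ least-anchor)
    a<k = Inside.lower (proj₁ k-anchor)
    k<b = Inside.upper (proj₁ k-anchor)

    -- The chord x y would cross the chord k b; without that chord, k + 1 = b leaves no room for y.
    crosses-k : ∀ {x y} → T (edge x y) → x Fin.< k → k Fin.< y → y Fin.< b → ⊥
    crosses-k xy x<k k<y y<b with proj₂ k-anchor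
    ... | inj₁ kb    = noncrossing xy kb (x<k , k<y , y<b)
    ... | inj₂ k+1≡b = <⇒≱ k<y (≤-pred (subst (_ <_) (sym k+1≡b) y<b))

    closed₁ : Closed a k
    closed₁ {v} {u} (between a<v v<k) vu =
      let v∈ = between a<v (<-trans v<k k<b)
          a≤u , u≤b = closed v∈ vu
          beyond : ¬ k Fin.< u
          beyond k<u = case m≤n⇒m<n∨m≡n u≤b of λ where
            (inj₁ u<b) → crosses-k vu v<k k<u u<b
            (inj₂ u≡b) → below-k v<k (v∈ , inj₁ (subst (T ∘ edge v) (Fin.toℕ-injective u≡b) vu))
      in a≤u , ≮⇒≥ beyond

    closed₂ : Closed k b
    closed₂ {v} {u} (between k<v v<b) vu =
      let a≤u , u≤b = closed (between (<-trans a<k k<v) v<b) vu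
      in ≮⇒≥ (λ u<k → crosses-k (edge-sym vu) u<k k<v v<b) , u≤b

  realize : ∀ {a b} → a Fin.< b → Closed a b → ∃ λ t → Realizes t a b
  realize a<b closed = go a<b closed (<-wellFounded _)
    where
    go : ∀ {a b} → a Fin.< b → Closed a b → Acc _<_ (toℕ b ∸ toℕ a) → ∃ λ t → Realizes t a b
    go {a} {b} a<b closed (acc shorter) with toℕ b ℕ.≟ suc (toℕ a)
    ... | yes b≡1+a = 0F , adjacent-realizes b≡1+a
    ... | no  b≢1+a =
      let k , a<k , k<b , closed₁ , closed₂ = split a<b b≢1+a closed
          t₁ , R₁ = go a<k closed₁ (shorter (∸-monoˡ-< k<b (<⇒≤ a<k)))
          t₂ , R₂ = go k<b closed₂ (shorter (∸-monoʳ-< a<k (<⇒≤ k<b)))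
      in  t₁ ⊕ t₂ , Join.⊕-realizes a<k k<b closed closed₁ closed₂ R₁ R₂

  delete-endpoints : ∀ {a b sa sb β} → (∀ u → a Fin.≤ u × u Fin.≤ b) → a Fin.< b → Solution a b sa sb β →
                     β + 3 * (indicator (isDeleted sa) + indicator (isDeleted sb)) ≤ 6 →
                     ∃ λ Z → (∀ v → Z v ≡ false → keptDegree edge Z v ≤ 3) × 3 * count Z ≤ interiorSize a b + 2
  delete-endpoints {a} {b} {sa} {sb} spans a<b S fit = Z , degree≤3 , size
    where
    open Solution S
    da = isDeleted sa
    db = isDeleted sb

    Z : Fin n → Bool
    Z u = X u ∨ (da ∧ (u ≡ᵇ a)) ∨ (db ∧ (u ≡ᵇ b))

    a≢b : a ≢ b
    a≢b refl = <-irrefl refl a<b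

    at : ∀ x → (x ≡ᵇ x) ≡ true
    at x = Equivalence.to T-≡ (≡ᵇ-refl x)

    extends : Extends a b sa sb X Z
    extends = record
      { on-inside = λ {v} v∈ → begin
          X v ∨ (da ∧ (v ≡ᵇ a)) ∨ (db ∧ (v ≡ᵇ b))
            ≡⟨ cong₂ (λ x y → X v ∨ (da ∧ x) ∨ (db ∧ y)) (≢⇒≡ᵇ-false {u = v} {a} λ { refl → Inside-irreflˡ v∈ })
                                                          (≢⇒≡ᵇ-false {u = v} {b} λ { refl → Inside-irreflʳ v∈ }) ⟩
          X v ∨ (da ∧ false) ∨ (db ∧ false)
            ≡⟨ cong₂ (λ x y → X v ∨ x ∨ y) (∧-zeroʳ da) (∧-zeroʳ db) ⟩
          X v ∨ false
            ≡⟨ ∨-identityʳ (X v) ⟩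
          X v ∎
      ; at-left = begin
          X a ∨ (da ∧ (a ≡ᵇ a)) ∨ (db ∧ (a ≡ᵇ b))
            ≡⟨ cong₂ (λ x y → x ∨ (da ∧ y) ∨ (db ∧ (a ≡ᵇ b))) (outside supported Inside-irreflˡ) (at a) ⟩
          (da ∧ true) ∨ (db ∧ (a ≡ᵇ b))
            ≡⟨ cong₂ _∨_ (∧-identityʳ da) (trans (cong (db ∧_) (≢⇒≡ᵇ-false a≢b)) (∧-zeroʳ db)) ⟩
          da ∨ false
            ≡⟨ ∨-identityʳ da ⟩
          da ∎
      ; at-right = begin
          X b ∨ (da ∧ (b ≡ᵇ a)) ∨ (db ∧ (b ≡ᵇ b))
            ≡⟨ cong₂ (λ x y → x ∨ (da ∧ y) ∨ (db ∧ (b ≡ᵇ b))) (outside supported Inside-irreflʳ)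
                                                               (≢⇒≡ᵇ-false (a≢b ∘ sym)) ⟩
          (da ∧ false) ∨ (db ∧ (b ≡ᵇ b))
            ≡⟨ cong₂ _∨_ (∧-zeroʳ da) (trans (cong (db ∧_) (at b)) (∧-identityʳ db)) ⟩
          db ∎
      }
      where open ≡-Reasoning

    V = valid extends

    degree≤3 : ∀ v → Z v ≡ false → keptDegree edge Z v ≤ 3
    degree≤3 v Zv with Inside-or-end (proj₁ (spans v)) (proj₂ (spans v))
    ... | inj₁ refl = ≤-trans (keptDegree-within Z (λ _ → spans _))
      (+-mono-≤ (+-mono-≤ (Allows⇒≤2 sa (Valid.left-budget V) (trans (sym (Extends.at-left extends)) Zv))
                          ([kept-self]≤0 Z a))
                (indicator≤1 _))
    ... | inj₂ (inj₁ v∈) = Valid.inner-degree V v∈ Zv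
    ... | inj₂ (inj₂ refl) = ≤-trans (keptDegree-within Z (λ _ → spans _))
      (+-mono-≤ (+-mono-≤ (Allows⇒≤2 sb (Valid.right-budget V) (trans (sym (Extends.at-right extends)) Zv))
                          (indicator≤1 _))
                ([kept-self]≤0 Z b))

    count-Z : count Z ≤ count X + (indicator da + indicator db)
    count-Z = begin
      count Z
        ≤⟨ count-∨ X _ ⟩
      count X + count (λ u → (da ∧ (u ≡ᵇ a)) ∨ (db ∧ (u ≡ᵇ b)))
        ≤⟨ +-monoʳ-≤ (count X) (count-∨ (λ u → da ∧ (u ≡ᵇ a)) (λ u → db ∧ (u ≡ᵇ b))) ⟩
      count X + (count (λ u → da ∧ (u ≡ᵇ a)) + count (λ u → db ∧ (u ≡ᵇ b)))
        ≤⟨ +-monoʳ-≤ (count X) (+-mono-≤ (count-at (λ _ → da) a) (count-at (λ _ → db) b)) ⟩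
      count X + (indicator da + indicator db) ∎
      where open ≤-Reasoning

    size : 3 * count Z ≤ interiorSize a b + 2
    size = root-cost {c₀ = count X} {m = interiorSize a b} count-Z cost fit

sparse-deletion : ∀ {n} (D : NoncrossingDiagram n) →
                  ∃ λ Z → (∀ v → Z v ≡ false → keptDegree (NoncrossingDiagram.edge D) Z v ≤ 3) × 3 * count Z ≤ n
sparse-deletion {zero}        D = (λ _ → false) , (λ ()) , z≤n
sparse-deletion {suc zero}    D =
  (λ _ → false) , (λ v _ → ≤-trans (count≤n (keptNeighbour E (λ _ → false) v)) (s≤s z≤n)) , z≤n
  where E = NoncrossingDiagram.edge D
sparse-deletion {suc (suc m)} D =
  let t , R = realize D first<last (λ _ _ → spans _)
      sa , sb , β , eq , fit = root-choice t
      Z , degree≤3 , size = delete-endpoints D spans first<last (R eq) fit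
  in  Z , degree≤3 , subst (3 * count Z ≤_) size≡ size
  where
  first last : Fin (suc (suc m))
  first = zero
  last  = Fin.fromℕ (suc m)
  first<last : first Fin.< last
  first<last rewrite Fin.toℕ-fromℕ (suc m) = s≤s z≤n
  spans : ∀ u → first Fin.≤ u × u Fin.≤ last
  spans u rewrite Fin.toℕ-fromℕ (suc m) = z≤n , Fin.toℕ≤pred[n] u
  size≡ : interiorSize D first last + 2 ≡ suc (suc m)
  size≡ rewrite Fin.toℕ-fromℕ m = +-comm m 2

-- Outerplanar graphs

circular-order : ∀ {n} (G : Graph n) → Outerplanar G → NoncrossingDiagram n
circular-order G O = record
  { edge        = λ p q → adj G (π ⟨$⟩ˡ p) (π ⟨$⟩ˡ q)
  ; edge-sym    = subst T (Graph.sym G _ _)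
  ; edge-irrefl = subst T (irrefl G _)
  ; noncrossing = λ pq rs (p<r , r<q , q<s) →
      Outerplanar.noncrossing O _ _ _ _ (Equivalence.to T-≡ pq) (Equivalence.to T-≡ rs)
        (at-position p<r , at-position r<q , at-position q<s)
  }
  where
  π = Outerplanar.pos O
  at-position : ∀ {p q} → p Fin.< q → π ⟨$⟩ʳ (π ⟨$⟩ˡ p) Fin.< π ⟨$⟩ʳ (π ⟨$⟩ˡ q)
  at-position = subst₂ Fin._<_ (sym (inverseʳ π)) (sym (inverseʳ π))

module _ {n} (G : Graph n) (O : Outerplanar G) (Z : Fin n → Bool) where
  private
    π = Outerplanar.pos O
    E = NoncrossingDiagram.edge (circular-order G O)

  survivors : Subset n
  survivors = tabulate (λ v → not (Z (π ⟨$⟩ʳ v)))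

  survivor-kept : ∀ {v} → v Subset.∈ survivors → Z (π ⟨$⟩ʳ v) ≡ false
  survivor-kept {v} v∈ =
    trans (sym (not-involutive _)) (cong not (trans (sym (lookup∘tabulate _ v)) ([]=⇒lookup v∈)))

  ∣survivors∣ : ∣ survivors ∣ ≡ count (not ∘ Z)
  ∣survivors∣ = begin
    ∣ survivors ∣
      ≡⟨ count-tabulate (Bool._≟ true) (λ v → not (Z (π ⟨$⟩ʳ v))) ⟩
    count (λ v → does (not (Z (π ⟨$⟩ʳ v)) Bool.≟ true))
      ≡⟨ count-cong (λ v → does-≟true (not (Z (π ⟨$⟩ʳ v)))) ⟩
    count (λ v → not (Z (π ⟨$⟩ʳ v)))
      ≡⟨ count-permute (not ∘ Z) π ⟨
    count (not ∘ Z) ∎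
    where
    open ≡-Reasoning
    does-≟true : ∀ x → does (x Bool.≟ true) ≡ x
    does-≟true false = refl
    does-≟true true  = refl

  inducedDegree-survivors : ∀ v → inducedDegree G survivors v ≡ keptDegree E Z (π ⟨$⟩ʳ v)
  inducedDegree-survivors v = begin
    inducedDegree G survivors v
      ≡⟨ count-tabulate (λ u → T? (Vec.lookup survivors u ∧ adj G v u)) id ⟩
    count (λ u → Vec.lookup survivors u ∧ adj G v u)
      ≡⟨ count-cong {p = λ u → Vec.lookup survivors u ∧ adj G v u}
                    {q = keptNeighbour E Z (π ⟨$⟩ʳ v) ∘ (π ⟨$⟩ʳ_)}
                    (λ u → cong₂ _∧_ (lookup∘tabulate _ u)
                                     (cong₂ (adj G) (sym (inverseˡ π)) (sym (inverseˡ π)))) ⟩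
    count (keptNeighbour E Z (π ⟨$⟩ʳ v) ∘ (π ⟨$⟩ʳ_))
      ≡⟨ count-permute (keptNeighbour E Z (π ⟨$⟩ʳ v)) π ⟨
    keptDegree E Z (π ⟨$⟩ʳ v) ∎
    where open ≡-Reasoning

-- The bound also holds for n = 0.
theorem5 : ∀ (n : ℕ) → 1 ≤ n → (G : Graph n) → Outerplanar G →
    Σ (Subset n) (λ I → InducedMaxDegree≤ G I 3 × 2 * n ≤ 3 * ∣ I ∣)
theorem5 n _ G O =
  let Z , Z-degree≤3 , Z-size = sparse-deletion (circular-order G O)
  in  survivors G O Z
    , (λ v v∈ → subst (_≤ 3) (sym (inducedDegree-survivors G O Z v)) (Z-degree≤3 _ (survivor-kept G O Z v∈)))
    , subst (λ c → 2 * n ≤ 3 * c) (sym (∣survivors∣ G O Z))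
            (3d≤n⇒2n≤3k {count Z} {count (not ∘ Z)} (count-not Z) Z-size)
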